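{- There is an attention head $\mathit{att}_\le$ in $\mathcal{T}_{\mathit{udec}}$ such that for all sequences $\boldsymbol{x}_1,\dots,\boldsymbol{x}_m$ where all $\boldsymbol{x}_i=(1,i,\boldsymbol{y}_i)$ (for arbitrary real vectors $\boldsymbol{y}_i$ of a common dimension), the head $\mathit{att}_\le$ attends to $\{\boldsymbol{x}_1,\dots,\boldsymbol{x}_i\}$ given position $i$.
   Context: An attention head in $\mathcal{T}_{\mathit{udec}}$ is a pair $(\mathit{score},\mathit{pool})$ with scoring function $\mathit{score}(\boldsymbol{x},\boldsymbol{y})=N(\langle Q\boldsymbol{x},K\boldsymbol{y}\rangle)$, where $Q,K$ are linear maps (matrices), $\langle\cdot,\cdot\rangle$ is the standard scalar product and $N$ is a feed-forward neural network with ReLU activations, and pooling $\mathit{pool}(\boldsymbol{x}_1,\dots,\boldsymbol{x}_m,s_1,\dots,s_m)=\sum_{i'}\mathrm{hardmax}(i',s_1,\dots,s_m)W\boldsymbol{x}_{i'}$ for a matrix $W$. Here $\mathrm{hardmax}(i',s_1,\dots,s_m)=\frac1r$ if $s_{i'}\ge s_j$ for all $j$, where $r$ is the number of $j$ with $s_j=s_{i'}$, and $0$ otherwise. The head attends to a set $M$ of positions given position $i$ if $M$ is exactly the set of positions $j$ with $\mathrm{hardmax}(j,\mathit{score}(\boldsymbol{x}_i,\boldsymbol{x}_1),\dots,\mathit{score}(\boldsymbol{x}_i,\boldsymbol{x}_m))\neq0$.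
   Formalization: The vectors $\boldsymbol{y}_i$ have rational entries rather than real ones, and the head's matrices and the weights of its ReLU network are taken in the rationals. -}

module Defs where

open import Data.Nat as ℕ using (ℕ; zero; suc)
open import Data.Fin using (Fin; toℕ; _≟_)
open import Data.Fin.Properties using (all?)
open import Data.Integer using (+_)
open import Data.Rational as ℚ using (ℚ; 0ℚ; 1ℚ; _+_; _*_; _≤_; _⊔_)
open import Data.Vec using (Vec; []; _∷_; map; zipWith; foldr)
open import Data.List using (length; filter)
open import Data.List.Base using ()
open import Data.Fin.Base using ()
open import Data.Product using (_×_)
open import Relation.Nullary using (¬_; yes; no)
open import Relation.Nullary.Decidable using (_×-dec_; ¬?)
open import Data.List using (List)
open import Data.List.Base using () renaming (allFin to allFinL)

-- Rationals stand in for reals.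

QVec : ℕ → Set
QVec d = Vec ℚ d

Mat : ℕ → ℕ → Set
Mat k d = Vec (Vec ℚ d) k

⟨_,_⟩ : ∀ {d} → QVec d → QVec d → ℚ
⟨ u , v ⟩ = foldr _ _+_ 0ℚ (zipWith _*_ u v)

_·_ : ∀ {k d} → Mat k d → QVec d → QVec k
A · v = map (λ row → ⟨ row , v ⟩) A

relu : ℚ → ℚ
relu x = 0ℚ ⊔ x

data FNN (i o : ℕ) : Set where
  output : Mat o i → QVec o → FNN i o
  hidden : ∀ {h} → Mat h i → QVec h → FNN h o → FNN i o

evalFNN : ∀ {i o} → FNN i o → QVec i → QVec o
evalFNN (output A b) x = zipWith _+_ (A · x) b
evalFNN (hidden A b N) x = evalFNN N (map relu (zipWith _+_ (A · x) b))

-- an attention head of T_udec on inputs of dimension d: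
-- score(x,y) = N(⟨Qx,Ky⟩),  pool uses the matrix W
record Head (d : ℕ) : Set where
  field
    k   : ℕ
    e   : ℕ
    Q   : Mat k d
    K   : Mat k d
    N   : FNN 1 1
    W   : Mat e d

score : ∀ {d} → Head d → QVec d → QVec d → ℚ
score h x y with evalFNN (Head.N h) (⟨ Head.Q h · x , Head.K h · y ⟩ ∷ [])
... | z ∷ [] = z

-- hardmax(j, s_1..s_m) = 1/r if s_j ≥ s_l for all l, where r = #{l | s_l = s_j}
-- (r is written as 1 + #{l ≠ j | s_l = s_j}), and 0 otherwise
hardmax : ∀ {m} → Fin m → (Fin m → ℚ) → ℚ
hardmax {m} j s with all? (λ l → s l ℚ.≤? s j)
... | no _  = 0ℚ
... | yes _ = (+ 1) ℚ./ suc (length (filter (λ l → ¬? (l ≟ j) ×-dec (s l ℚ.≟ s j)) (allFinL m)))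

Attends : ∀ {d m} → Head d → (Fin m → QVec d) → Fin m → (Fin m → Set) → Set
Attends h x i M = ∀ j → (¬ (hardmax j (λ l → score h (x i) (x l)) ≡ 0ℚ) → M j)
                       × (M j → ¬ (hardmax j (λ l → score h (x i) (x l)) ≡ 0ℚ))
  where open import Relation.Binary.PropositionalEquality using (_≡_)

-- position j (0-based Fin) is the paper's position toℕ j + 1
pos : ∀ {m} → Fin m → ℚ
pos j = (+ suc (toℕ j)) ℚ./ 1

inputs : ∀ {n m} → (Fin m → QVec n) → Fin m → QVec (suc (suc n))
inputs y j = 1ℚ ∷ pos j ∷ y j

{-# OPTIONS --safe #-}
module Submission where

-- With Q x = (x₁, x₂) and K y = (y₂, -y₁), the bilinear form ⟨Q xᵢ, K xⱼ⟩ on inputs xⱼ = (1, j, yⱼ)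
-- is j - i, and the network N z = -relu z turns it into the score min(0, i - j).  For fixed i
-- this score is at most 0, equals 0 exactly for j ≤ i and is negative for j > i, so the
-- maximal scores, i.e. the support of hardmax, are exactly the positions j ≤ i.

open import Defs
open import Data.Empty using (⊥-elim)
open import Data.Fin using (Fin; toℕ; _≟_)
open import Data.Fin.Properties using (all?)
open import Data.Integer as ℤ using (+_)
import Data.Integer.Properties as ℤP
import Data.List as List
open import Data.Nat as ℕ using (ℕ; suc; _≤_; s≤s)
import Data.Nat.Coprimality as Coprimality
import Data.Nat.Properties as ℕP
open import Data.Product using (Σ-syntax; ∃-syntax; _×_; _,_; proj₂)
open import Data.Rational as ℚ using (ℚ; 0ℚ; 1ℚ; -_; _-_; _+_; _*_; _<_)
import Data.Rational.Properties as ℚP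
open import Data.Rational.Solver using (module +-*-Solver)
open import Data.Vec using ([]; _∷_; replicate; head)
open import Function using (_∘_; const)
open import Relation.Binary.PropositionalEquality
open import Relation.Nullary using (¬_; yes; no; contradiction)
open import Relation.Nullary.Decidable using (¬?; _×-dec_)
open import Relation.Unary using (Decidable)

zeros : ∀ n → QVec n
zeros n = replicate n 0ℚ

⟨⟩-zeroˡ : ∀ {n} (u : QVec n) → ⟨ zeros n , u ⟩ ≡ 0ℚ
⟨⟩-zeroˡ []      = refl
⟨⟩-zeroˡ (p ∷ u) rewrite ⟨⟩-zeroˡ u | ℚP.*-zeroˡ p = refl

-relu≤0 : ∀ p → - relu p ℚ.≤ 0ℚ
-relu≤0 p = ℚP.neg-antimono-≤ (ℚP.p≤p⊔q 0ℚ p)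

p≤q⇒-relu[p-q]≡0 : ∀ {p q} → p ℚ.≤ q → - relu (p - q) ≡ 0ℚ
p≤q⇒-relu[p-q]≡0 {p} {q} p≤q = cong -_ (ℚP.p≥q⇒p⊔q≡p p-q≤0)
  where
  p-q≤0 : p - q ℚ.≤ 0ℚ
  p-q≤0 = subst (p - q ℚ.≤_) (ℚP.+-inverseʳ q) (ℚP.+-monoˡ-≤ (- q) p≤q)

p<q⇒-relu[q-p]<0 : ∀ {p q} → p < q → - relu (q - p) < 0ℚ
p<q⇒-relu[q-p]<0 {p} {q} p<q =
  subst (λ r → - r < 0ℚ) (sym (ℚP.p≤q⇒p⊔q≡q (ℚP.<⇒≤ 0<q-p))) (ℚP.neg-antimono-< 0<q-p)
  where
  0<q-p : 0ℚ < q - p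
  0<q-p = subst (_< q - p) (ℚP.+-inverseʳ p) (ℚP.+-monoˡ-< (- p) p<q)

+n/1≡mkℚ : ∀ n → + n ℚ./ 1 ≡ ℚ.mkℚ (+ n) 0 (Coprimality.sym (Coprimality.1-coprimeTo n))
+n/1≡mkℚ n = ℚP.normalize-coprime (Coprimality.sym (Coprimality.1-coprimeTo n))

+/1-mono-≤ : ∀ {m n} → m ≤ n → + m ℚ./ 1 ℚ.≤ + n ℚ./ 1
+/1-mono-≤ {m} {n} m≤n rewrite +n/1≡mkℚ m | +n/1≡mkℚ n =
  ℚ.*≤* (ℤP.*-monoʳ-≤-nonNeg (+ 1) (ℤ.+≤+ m≤n))

+/1-mono-< : ∀ {m n} → m ℕ.< n → + m ℚ./ 1 < + n ℚ./ 1
+/1-mono-< {m} {n} m<n rewrite +n/1≡mkℚ m | +n/1≡mkℚ n =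
  ℚ.*<* (ℤP.*-monoʳ-<-pos (+ 1) (ℤ.+<+ m<n))

pos-mono-≤ : ∀ {m} {j l : Fin m} → toℕ j ≤ toℕ l → pos j ℚ.≤ pos l
pos-mono-≤ j≤l = +/1-mono-≤ (s≤s j≤l)

pos-mono-< : ∀ {m} {j l : Fin m} → toℕ j ℕ.< toℕ l → pos j < pos l
pos-mono-< j<l = +/1-mono-< (s≤s j<l)

1/suc≢0 : ∀ r → + 1 ℚ./ suc r ≢ 0ℚ
1/suc≢0 r 1/r≡0 =
  ℚP.<⇒≢ (ℚP.positive⁻¹ (+ 1 ℚ./ suc r) {{ℚP.normalize-pos 1 (suc r)}}) (sym 1/r≡0)

maximal⇒hardmax≢0 : ∀ {m} {j : Fin m} {s : Fin m → ℚ} → (∀ l → s l ℚ.≤ s j) → hardmax j s ≢ 0ℚ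
maximal⇒hardmax≢0 {m} {j} {s} maximal with all? (λ l → s l ℚ.≤? s j)
... | no ¬maximal = λ _ → ¬maximal maximal
... | yes _       = 1/suc≢0 (List.length (List.filter (λ l → ¬? (l ≟ j) ×-dec (s l ℚ.≟ s j)) (List.allFin m)))

<⇒hardmax≡0 : ∀ {m} {j l : Fin m} {s : Fin m → ℚ} → s j < s l → hardmax j s ≡ 0ℚ
<⇒hardmax≡0 {m} {j} {l} {s} sj<sl with all? (λ l → s l ℚ.≤? s j)
... | no _        = refl
... | yes maximal = ⊥-elim (ℚP.<-irrefl refl (ℚP.<-≤-trans sj<sl (maximal l)))

hardmax-support : ∀ {m} {s : Fin m → ℚ} {M : Fin m → Set} → Decidable M →
                  (∀ {j} → M j → ∀ l → s l ℚ.≤ s j) →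
                  (∀ {j} → ¬ M j → ∃[ l ] s j < s l) →
                  ∀ j → (hardmax j s ≢ 0ℚ → M j) × (M j → hardmax j s ≢ 0ℚ)
hardmax-support {s = s} M? maximal dominated j with M? j
... | yes Mj  = const Mj , const (maximal⇒hardmax≢0 {s = s} (maximal Mj))
... | no ¬Mj = (λ hardmax≢0 → contradiction (<⇒hardmax≡0 {s = s} (proj₂ (dominated ¬Mj))) hardmax≢0)
             , λ Mj → contradiction Mj ¬Mj

negReLU : FNN 1 1
negReLU = FNN.hidden ((1ℚ ∷ []) ∷ []) (0ℚ ∷ []) (FNN.output ((- 1ℚ ∷ []) ∷ []) (0ℚ ∷ []))

evalFNN-negReLU : ∀ z → evalFNN negReLU (z ∷ []) ≡ - relu z ∷ []
evalFNN-negReLU z = cong (_∷ []) (begin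
  - 1ℚ * relu (1ℚ * z + 0ℚ + 0ℚ) + 0ℚ + 0ℚ  ≡⟨ cong (λ w → - 1ℚ * relu w + 0ℚ + 0ℚ) (1*p+0+0≡p z) ⟩
  - 1ℚ * relu z + 0ℚ + 0ℚ                   ≡⟨ -1*p+0+0≡-p (relu z) ⟩
  - relu z                                  ∎)
  where
  open ≡-Reasoning
  open +-*-Solver
  1*p+0+0≡p : ∀ p → 1ℚ * p + 0ℚ + 0ℚ ≡ p
  1*p+0+0≡p = solve 1 (λ p → con 1ℚ :* p :+ con 0ℚ :+ con 0ℚ := p) refl
  -1*p+0+0≡-p : ∀ p → - 1ℚ * p + 0ℚ + 0ℚ ≡ - p
  -1*p+0+0≡-p = solve 1 (λ p → con (- 1ℚ) :* p :+ con 0ℚ :+ con 0ℚ := :- p) refl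

att≤ : ∀ n → Head (suc (suc n))
att≤ n = record
  { k = 2 ; e = 1
  ; Q = (1ℚ ∷ 0ℚ ∷ zeros n) ∷ (0ℚ ∷ 1ℚ ∷ zeros n) ∷ []
  ; K = (0ℚ ∷ 1ℚ ∷ zeros n) ∷ (- 1ℚ ∷ 0ℚ ∷ zeros n) ∷ []
  ; N = negReLU
  ; W = zeros _ ∷ [] }

module _ {n : ℕ} (a b : ℚ) (u v : QVec n) where
  open Head (att≤ n)

  att≤-query·key : ⟨ Q · (1ℚ ∷ a ∷ u) , K · (1ℚ ∷ b ∷ v) ⟩ ≡ b - a
  att≤-query·key rewrite ⟨⟩-zeroˡ u | ⟨⟩-zeroˡ v = solve 2 (λ a b →
      (con 1ℚ :+ (con 0ℚ :* a :+ con 0ℚ)) :* (con 0ℚ :+ (con 1ℚ :* b :+ con 0ℚ))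
    :+ ((con 0ℚ :+ (con 1ℚ :* a :+ con 0ℚ)) :* (con (- 1ℚ) :+ (con 0ℚ :* b :+ con 0ℚ)) :+ con 0ℚ)
    := b :- a) refl a b
    where open +-*-Solver

  att≤-score : score (att≤ n) (1ℚ ∷ a ∷ u) (1ℚ ∷ b ∷ v) ≡ - relu (b - a)
  att≤-score = begin
    score (att≤ n) (1ℚ ∷ a ∷ u) (1ℚ ∷ b ∷ v)  ≡⟨ cong head (evalFNN-negReLU query·key) ⟩
    - relu query·key                          ≡⟨ cong (-_ ∘ relu) att≤-query·key ⟩
    - relu (b - a)                            ∎
    where
    open ≡-Reasoning
    query·key : ℚ
    query·key = ⟨ Q · (1ℚ ∷ a ∷ u) , K · (1ℚ ∷ b ∷ v) ⟩

module _ {n m : ℕ} (y : Fin m → QVec n) (i : Fin m) where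
  private
    score≡ : ∀ l → score (att≤ n) (inputs y i) (inputs y l) ≡ - relu (pos l - pos i)
    score≡ l = att≤-score (pos i) (pos l) (y i) (y l)

  att≤-score≤0 : ∀ l → score (att≤ n) (inputs y i) (inputs y l) ℚ.≤ 0ℚ
  att≤-score≤0 l = subst (ℚ._≤ 0ℚ) (sym (score≡ l)) (-relu≤0 (pos l - pos i))

  att≤-score≡0 : ∀ l → toℕ l ≤ toℕ i → score (att≤ n) (inputs y i) (inputs y l) ≡ 0ℚ
  att≤-score≡0 l l≤i = trans (score≡ l) (p≤q⇒-relu[p-q]≡0 (pos-mono-≤ l≤i))

  att≤-score<0 : ∀ l → toℕ i ℕ.< toℕ l → score (att≤ n) (inputs y i) (inputs y l) < 0ℚ
  att≤-score<0 l i<l = subst (_< 0ℚ) (sym (score≡ l)) (p<q⇒-relu[q-p]<0 (pos-mono-< i<l))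

lemma6 : (n : ℕ) → Σ[ att ∈ Head (suc (suc n)) ]
           ((m : ℕ) (y : Fin m → QVec n) (i : Fin m) →
             Attends att (inputs y) i (λ j → toℕ j ≤ toℕ i))
lemma6 n = att≤ n , attends
  where
  attends : (m : ℕ) (y : Fin m → QVec n) (i : Fin m) →
            Attends (att≤ n) (inputs y) i (λ j → toℕ j ≤ toℕ i)
  attends m y i = hardmax-support {s = s} (λ j → toℕ j ℕ.≤? toℕ i) maximal dominated
    where
    s : Fin m → ℚ
    s l = score (att≤ n) (inputs y i) (inputs y l)

    maximal : ∀ {j} → toℕ j ≤ toℕ i → ∀ l → s l ℚ.≤ s j
    maximal {j} j≤i l = subst (s l ℚ.≤_) (sym (att≤-score≡0 y i j j≤i)) (att≤-score≤0 y i l)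

    dominated : ∀ {j} → ¬ toℕ j ≤ toℕ i → ∃[ l ] s j < s l
    dominated {j} j≰i =
      i , subst (s j <_) (sym (att≤-score≡0 y i i ℕP.≤-refl)) (att≤-score<0 y i j (ℕP.≰⇒> j≰i))
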